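{- Let $G$ be a graph and let $l$ be an intersecting supermodular weakly subadditive integer-valued function on subsets of $V(G)$. Let $F$ be an $l$-sparse spanning subgraph of $G$. If $xy\in E(G)\setminus E(F)$ and $Q$ is an $l$-partition-connected subgraph of $F$ containing $x$ and $y$ with the minimum number of vertices, then for every $e\in E(Q)$, the graph $F-e+xy$ is $l$-sparse.
   Context: Graphs are finite, loopless, and may have multiple edges. $l(\emptyset)=0$, $l(v)=l(\{v\})$. $l$ is intersecting supermodular if $l(A\cap B)+l(A\cup B)\ge l(A)+l(B)$ whenever $A\cap B\neq\emptyset$; weakly subadditive if $\sum_{v\in A}l(v)\ge l(A)$ for all $A$. A spanning subgraph $F$ is $l$-sparse if $e_F(A)\le\sum_{v\in A}l(v)-l(A)$ for all vertex sets $A$, where $e_F(A)$ is the number of edges of $F$ with both ends in $A$. For a partition $P$ of $V(K)$, $e_K(P)$ is the number of edges joining different parts; $K$ is $l$-partition-connected if $e_K(P)\ge\sum_{A\in P}l(A)-l(V(K))$ for every partition $P$ of $V(K)$. -}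

module Defs where

open import Data.Nat using (ℕ)
open import Data.Integer using (ℤ; +_; _+_; _-_; _≤_)
open import Data.Bool using (Bool; true; false; _∧_; not; if_then_else_)
open import Data.Fin using (Fin; zero; suc; _≟_)
open import Data.Fin.Subset using (Subset; ⁅_⁆; ∣_∣; _∈_; _∉_; _⊆_; _∩_; _∪_; ⊥; Nonempty; inside; outside)
open import Data.Vec using (lookup; tabulate; _[_]≔_)
open import Data.Product using (_×_; proj₁; proj₂)
open import Relation.Nullary using (¬_; does)
open import Relation.Binary.PropositionalEquality using (_≡_)

record Graph (n m : ℕ) : Set where
  field
    ends     : Fin m → Fin n × Fin n
    loopless : ∀ i → ¬ (proj₁ (ends i) ≡ proj₂ (ends i))
open Graph public

end₁ end₂ : ∀ {n m} → Graph n m → Fin m → Fin n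
end₁ G i = proj₁ (ends G i)
end₂ G i = proj₂ (ends G i)

ΣFin : (k : ℕ) → (Fin k → ℤ) → ℤ
ΣFin ℕ.zero    f = + 0
ΣFin (ℕ.suc k) f = f zero + ΣFin k (λ i → f (suc i))

ΣOver : ∀ {n} → (Subset n → ℤ) → Subset n → ℤ
ΣOver {n} l A = ΣFin n (λ v → if lookup A v then l ⁅ v ⁆ else + 0)

IntersectingSupermodular : ∀ {n} → (Subset n → ℤ) → Set
IntersectingSupermodular l =
  ∀ A B → Nonempty (A ∩ B) → l A + l B ≤ l (A ∩ B) + l (A ∪ B)

WeaklySubadditive : ∀ {n} → (Subset n → ℤ) → Set
WeaklySubadditive l = ∀ A → l A ≤ ΣOver l A

-- e_F(A): number of edges of the edge set F (spanning subgraph of G) with both ends in A.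
eIn : ∀ {n m} → Graph n m → Subset m → Subset n → ℕ
eIn G F A = ∣ tabulate (λ i → lookup F i ∧ (lookup A (end₁ G i) ∧ lookup A (end₂ G i))) ∣

Sparse : ∀ {n m} → Graph n m → (Subset n → ℤ) → Subset m → Set
Sparse G l F = ∀ A → + eIn G F A ≤ ΣOver l A - l A

record Subgraph {n m : ℕ} (G : Graph n m) : Set where
  field
    V      : Subset n
    E      : Subset m
    closed : ∀ {i} → i ∈ E → (end₁ G i ∈ V) × (end₂ G i ∈ V)
open Subgraph public

-- A partition of V(K) into k (nonempty) parts is given by a labelling c : Fin n → Fin k
-- restricted to V(K); part j is {v ∈ V(K) : c v = j}, required nonempty.
part : ∀ {n k} → Subset n → (Fin n → Fin k) → Fin k → Subset n
part S c j = tabulate (λ v → lookup S v ∧ does (c v ≟ j))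

crossing : ∀ {n m k} {G : Graph n m} → Subgraph G → (Fin n → Fin k) → ℕ
crossing {G = G} K c =
  ∣ tabulate (λ i → lookup (E K) i ∧ not (does (c (end₁ G i) ≟ c (end₂ G i)))) ∣

PartitionConnected : ∀ {n m} {G : Graph n m} → (Subset n → ℤ) → Subgraph G → Set
PartitionConnected {n} l K =
  ∀ (k : ℕ) (c : Fin n → Fin k) →
    (∀ j → Nonempty (part (V K) c j)) →
    ΣFin k (λ j → l (part (V K) c j)) - l (V K) ≤ + crossing K c

SubOfContaining : ∀ {n m} {G : Graph n m} → Subset m → Fin n → Fin n → Subgraph G → Set
SubOfContaining F x y K = (E K ⊆ F) × (x ∈ V K) × (y ∈ V K)

swapEdge : ∀ {m} → Subset m → Fin m → Fin m → Subset m
swapEdge F e f = (F [ e ]≔ outside) [ f ]≔ inside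

-- If F - e + xy violated sparsity at A, counting edges inside A shows that xy lies inside A,
-- e does not, and A is tight for F: e_F(A) = Σ_{v∈A} l(v) - l(A). Then the restriction of Q
-- to A is again l-partition-connected: a partition of A ∩ V(Q), extended by singletons on
-- V(Q) ∖ A, is a partition of V(Q), and the bound for it, tightness of A, sparsity of F at
-- A ∪ V(Q) and supermodularity of l at A, V(Q) add up to the bound for the restriction.
-- By minimality of Q, V(Q) ⊆ A, so e lies inside A after all.

module Submission where

open import Defs
import Algebra.Properties.CommutativeMonoid.Sum as Sum
open import Data.Bool using (Bool; true; false; _∧_; _∨_; not; if_then_else_)
open import Data.Bool.Properties using (∧-conicalˡ; ∧-conicalʳ)
open import Data.Fin using (Fin; zero; suc; _≟_; punchIn; punchOut; _↑ˡ_; _↑ʳ_; splitAt)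
open import Data.Fin.Properties
  using (all?; ¬∀⟶∃¬; punchIn-injective; punchIn-punchOut; ↑ˡ-injective; ↑ʳ-injective; splitAt-↑ˡ; splitAt-↑ʳ)
open import Data.Fin.Subset using (Subset; ⁅_⁆; ∣_∣; _∈_; _∉_; _⊆_; _∩_; _∪_; ∁; ⊥; Nonempty; inside; outside)
open import Data.Fin.Subset.Properties
  using ( Empty-unique; nonempty?; _∈?_; ⊆-antisym; x∈p∩q⁺; x∈p∩q⁻; p⊆p∪q; q⊆p∪q; p∩q⊆q
        ; x∈⁅x⁆; x∈⁅y⁆⇒x≡y; x∈∁p⇒x∉p; x∉p⇒x∈∁p; p⊂q⇒∣p∣<∣q∣ )
open import Data.Integer as ℤ using (ℤ; +_; _+_; _-_; _≤_)
import Data.Integer.Properties as ℤP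
import Data.Integer.Tactic.RingSolver as ℤ-Solver
open import Data.Nat as ℕ using (ℕ; zero; suc)
import Data.Nat.Properties as ℕP
open import Algebra.Properties.CommutativeSemigroup ℕP.+-commutativeSemigroup using (xy∙z≈xz∙y)
open import Data.Product using (_×_; _,_; proj₁; proj₂)
open import Data.Sum using (_⊎_; inj₁; inj₂)
open import Data.Vec using (Vec; _∷_; lookup; tabulate; _[_]≔_)
open import Data.Vec.Properties
  using ( tabulate∘lookup; tabulate-cong; lookup∘tabulate; lookup∘update; lookup∘update′
        ; lookup-zipWith; lookup-map; []=⇒lookup; lookup⇒[]= )
open import Function using (_∘_; mk⇔)
open import Function.Definitions using (Injective)
open import Relation.Binary.PropositionalEquality
open import Relation.Nullary using (¬_; does; yes; no; contradiction)
open import Relation.Nullary.Decidable using (dec-true; dec-false; does-⇔)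

private
  module ℤΣ = Sum ℤP.+-0-commutativeMonoid
  module ℕΣ = Sum ℕP.+-0-commutativeMonoid

lookup-false⇒∉ : ∀ {n} {p : Subset n} {v} → lookup p v ≡ false → v ∉ p
lookup-false⇒∉ eq v∈p = contradiction (trans (sym ([]=⇒lookup v∈p)) eq) λ ()

∉⇒lookup-false : ∀ {n} {p : Subset n} {v} → v ∉ p → lookup p v ≡ false
∉⇒lookup-false {p = p} {v} v∉p with lookup p v in v∈p
... | true  = contradiction (lookup⇒[]= v p v∈p) v∉p
... | false = refl

↑ˡ≢↑ʳ : ∀ {k n} (i : Fin k) (j : Fin n) → i ↑ˡ n ≢ k ↑ʳ j
↑ˡ≢↑ʳ {k} {n} i j eq with trans (sym (splitAt-↑ˡ k i n)) (trans (cong (splitAt k) eq) (splitAt-↑ʳ k n j))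
... | ()

lookup-ext : ∀ {A : Set} {k} (u w : Vec A k) → (∀ i → lookup u i ≡ lookup w i) → u ≡ w
lookup-ext u w u≗w = trans (sym (tabulate∘lookup u)) (trans (tabulate-cong u≗w) (tabulate∘lookup w))

ΣFin≡sum : ∀ k (f : Fin k → ℤ) → ΣFin k f ≡ ℤΣ.sum f
ΣFin≡sum zero    f = refl
ΣFin≡sum (suc k) f = cong (_+_ (f zero)) (ΣFin≡sum k (f ∘ suc))

ΣFin-cong : ∀ k {f g : Fin k → ℤ} → f ≗ g → ΣFin k f ≡ ΣFin k g
ΣFin-cong k {f} {g} f≗g =
  trans (ΣFin≡sum k f) (trans (ℤΣ.sum-cong-≗ f≗g) (sym (ΣFin≡sum k g)))

ΣFin-distrib-+ : ∀ k (f g : Fin k → ℤ) → ΣFin k (λ i → f i + g i) ≡ ΣFin k f + ΣFin k g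
ΣFin-distrib-+ k f g = begin
  ΣFin k (λ i → f i + g i)     ≡⟨ ΣFin≡sum k _ ⟩
  ℤΣ.sum (λ i → f i + g i)     ≡⟨ ℤΣ.∑-distrib-+ f g ⟩
  ℤΣ.sum f + ℤΣ.sum g          ≡⟨ cong₂ _+_ (ΣFin≡sum k f) (ΣFin≡sum k g) ⟨
  ΣFin k f + ΣFin k g          ∎
  where open ≡-Reasoning

ΣFin-punchIn : ∀ k (f : Fin (suc k) → ℤ) j → ΣFin (suc k) f ≡ f j + ΣFin k (f ∘ punchIn j)
ΣFin-punchIn k f j = begin
  ΣFin (suc k) f                    ≡⟨ ΣFin≡sum (suc k) f ⟩
  ℤΣ.sum f                          ≡⟨ ℤΣ.sum-remove f ⟩
  f j + ℤΣ.sum (f ∘ punchIn j)      ≡⟨ cong (_+_ (f j)) (ΣFin≡sum k _) ⟨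
  f j + ΣFin k (f ∘ punchIn j)      ∎
  where open ≡-Reasoning

ΣFin-↑ : ∀ k n (f : Fin (k ℕ.+ n) → ℤ) →
         ΣFin (k ℕ.+ n) f ≡ ΣFin k (f ∘ (_↑ˡ n)) + ΣFin n (f ∘ (k ↑ʳ_))
ΣFin-↑ zero    n f = sym (ℤP.+-identityˡ _)
ΣFin-↑ (suc k) n f = trans (cong (_+_ (f zero)) (ΣFin-↑ k n (f ∘ suc))) (sym (ℤP.+-assoc (f zero) _ _))

toℕ : Bool → ℕ
toℕ true  = 1
toℕ false = 0

∣tabulate∣≡sum : ∀ {k} (p : Fin k → Bool) → ∣ tabulate p ∣ ≡ ℕΣ.sum (toℕ ∘ p)
∣tabulate∣≡sum {zero}  p = refl
∣tabulate∣≡sum {suc k} p with p zero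
... | true  = cong suc (∣tabulate∣≡sum (p ∘ suc))
... | false = ∣tabulate∣≡sum (p ∘ suc)

sum-mono-≤ : ∀ {k} {f g : Fin k → ℕ} → (∀ i → f i ℕ.≤ g i) → ℕΣ.sum f ℕ.≤ ℕΣ.sum g
sum-mono-≤ {zero}  f≤g = ℕ.z≤n
sum-mono-≤ {suc k} f≤g = ℕP.+-mono-≤ (f≤g zero) (sum-mono-≤ (f≤g ∘ suc))

∣tabulate∣-+ : ∀ {k} (p q r : Fin k → Bool) → (∀ i → toℕ (p i) ≡ toℕ (q i) ℕ.+ toℕ (r i)) →
               ∣ tabulate p ∣ ≡ ∣ tabulate q ∣ ℕ.+ ∣ tabulate r ∣
∣tabulate∣-+ p q r pointwise = begin
  ∣ tabulate p ∣                                  ≡⟨ ∣tabulate∣≡sum p ⟩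
  ℕΣ.sum (toℕ ∘ p)                                ≡⟨ ℕΣ.sum-cong-≗ pointwise ⟩
  ℕΣ.sum (λ i → toℕ (q i) ℕ.+ toℕ (r i))          ≡⟨ ℕΣ.∑-distrib-+ (toℕ ∘ q) (toℕ ∘ r) ⟩
  ℕΣ.sum (toℕ ∘ q) ℕ.+ ℕΣ.sum (toℕ ∘ r)           ≡⟨ cong₂ ℕ._+_ (∣tabulate∣≡sum q) (∣tabulate∣≡sum r) ⟨
  ∣ tabulate q ∣ ℕ.+ ∣ tabulate r ∣               ∎
  where open ≡-Reasoning

∣tabulate∣-+-≤ : ∀ {k} (p q r : Fin k → Bool) → (∀ i → toℕ (q i) ℕ.+ toℕ (r i) ℕ.≤ toℕ (p i)) →
                 ∣ tabulate q ∣ ℕ.+ ∣ tabulate r ∣ ℕ.≤ ∣ tabulate p ∣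
∣tabulate∣-+-≤ p q r pointwise = begin
  ∣ tabulate q ∣ ℕ.+ ∣ tabulate r ∣               ≡⟨ cong₂ ℕ._+_ (∣tabulate∣≡sum q) (∣tabulate∣≡sum r) ⟩
  ℕΣ.sum (toℕ ∘ q) ℕ.+ ℕΣ.sum (toℕ ∘ r)           ≡⟨ ℕΣ.∑-distrib-+ (toℕ ∘ q) (toℕ ∘ r) ⟨
  ℕΣ.sum (λ i → toℕ (q i) ℕ.+ toℕ (r i))          ≤⟨ sum-mono-≤ pointwise ⟩
  ℕΣ.sum (toℕ ∘ p)                                ≡⟨ ∣tabulate∣≡sum p ⟨
  ∣ tabulate p ∣                                  ∎
  where open ℕP.≤-Reasoning

∣p[i]≔b∣ : ∀ {k} (p : Subset k) i b → ∣ p [ i ]≔ b ∣ ℕ.+ toℕ (lookup p i) ≡ ∣ p ∣ ℕ.+ toℕ b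
∣p[i]≔b∣ (true  ∷ p) zero true  = refl
∣p[i]≔b∣ (true  ∷ p) zero false = ℕP.+-suc ∣ p ∣ 0
∣p[i]≔b∣ (false ∷ p) zero true  = sym (ℕP.+-suc ∣ p ∣ 0)
∣p[i]≔b∣ (false ∷ p) zero false = refl
∣p[i]≔b∣ (true  ∷ p) (suc i) b  = cong suc (∣p[i]≔b∣ p i b)
∣p[i]≔b∣ (false ∷ p) (suc i) b  = ∣p[i]≔b∣ p i b

LabellingBound : ∀ {n m k} {G : Graph n m} → (Subset n → ℤ) → Subgraph G → (Fin n → Fin k) → Set
LabellingBound {k = k} l K c = ΣFin k (λ j → l (part (V K) c j)) - l (V K) ≤ + crossing K c

module _ {n k : ℕ} (S : Subset n) (c : Fin n → Fin k) where

  ∈-part⁺ : ∀ {v j} → v ∈ S → c v ≡ j → v ∈ part S c j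
  ∈-part⁺ {v} {j} v∈S cv≡j = lookup⇒[]= v _
    (trans (lookup∘tabulate _ v) (cong₂ _∧_ ([]=⇒lookup v∈S) (dec-true (c v ≟ j) cv≡j)))

  ∈-part⁻ : ∀ {v j} → v ∈ part S c j → v ∈ S × c v ≡ j
  ∈-part⁻ {v} {j} v∈part with c v ≟ j | trans (sym (lookup∘tabulate _ v)) ([]=⇒lookup v∈part)
  ... | yes cv≡j | v∈S = lookup⇒[]= v S (∧-conicalˡ _ _ v∈S) , cv≡j
  ... | no _     | v∈S = contradiction (∧-conicalʳ (lookup S v) _ v∈S) λ ()

  ∉-emptyPart : ∀ {j v} → ¬ Nonempty (part S c j) → v ∈ S → c v ≢ j
  ∉-emptyPart empty v∈S cv≡j = empty (_ , ∈-part⁺ v∈S cv≡j)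

module _ {n k k′ : ℕ} {S : Subset n} {c : Fin n → Fin k} {c′ : Fin n → Fin k′}
         {ι : Fin k′ → Fin k} (ι-injective : Injective _≡_ _≡_ ι)
         (c≡ι∘c′ : ∀ {v} → v ∈ S → c v ≡ ι (c′ v)) where

  part-relabel : ∀ i → part S c (ι i) ≡ part S c′ i
  part-relabel i = tabulate-cong same
    where
    same : ∀ v → (lookup S v ∧ does (c v ≟ ι i)) ≡ (lookup S v ∧ does (c′ v ≟ i))
    same v with lookup S v in v∈S
    ... | false = refl
    ... | true  = does-⇔ (mk⇔ (λ eq → ι-injective (trans (sym (c≡ι∘c′ v∈S′)) eq))
                              (λ eq → trans (c≡ι∘c′ v∈S′) (cong ι eq))) (c v ≟ ι i) (c′ v ≟ i)
      where v∈S′ = lookup⇒[]= v S v∈S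

  crossing-relabel : ∀ {m} {G : Graph n m} (K : Subgraph G) → V K ⊆ S → crossing K c ≡ crossing K c′
  crossing-relabel {G = G} K K⊆S = cong ∣_∣ (tabulate-cong same)
    where
    same : ∀ i → (lookup (E K) i ∧ not (does (c (end₁ G i) ≟ c (end₂ G i)))) ≡
                 (lookup (E K) i ∧ not (does (c′ (end₁ G i) ≟ c′ (end₂ G i))))
    same i with lookup (E K) i in i∈K
    ... | false = refl
    ... | true  = cong not (does-⇔ (mk⇔
                    (λ eq → ι-injective (trans (sym (c≡ι∘c′ a∈S)) (trans eq (c≡ι∘c′ b∈S))))
                    (λ eq → trans (c≡ι∘c′ a∈S) (trans (cong ι eq) (sym (c≡ι∘c′ b∈S)))))
                    (c _ ≟ c _) (c′ _ ≟ c′ _))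
      where
      a∈S = K⊆S (proj₁ (closed K (lookup⇒[]= i (E K) i∈K)))
      b∈S = K⊆S (proj₂ (closed K (lookup⇒[]= i (E K) i∈K)))

-- Vertices labelled j get the new label of x as a junk value: it is the only element of Fin k at hand.
dropPart : ∀ {n k} (c : Fin n → Fin (suc k)) j {x} → c x ≢ j → Fin n → Fin k
dropPart c j cx≢j v with c v ≟ j
... | yes _    = punchOut (cx≢j ∘ sym)
... | no cv≢j = punchOut (cv≢j ∘ sym)

dropPart-punchIn : ∀ {n k} (c : Fin n → Fin (suc k)) j {x} (cx≢j : c x ≢ j) {v} → c v ≢ j →
                   c v ≡ punchIn j (dropPart c j cx≢j v)
dropPart-punchIn c j cx≢j {v} cv≢j with c v ≟ j
... | yes cv≡j = contradiction cv≡j cv≢j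
... | no cv≢j′ = sym (punchIn-punchOut (cv≢j′ ∘ sym))

module _ {n m} {G : Graph n m} (l : Subset n → ℤ) (l⊥ : l ⊥ ≡ + 0) (K : Subgraph G)
         (K-nonempty : Nonempty (V K)) (pc : PartitionConnected l K) where

  -- Empty parts contribute l ⊥ = 0, so they can be dropped without changing either side.
  PartitionConnected⇒LabellingBound : ∀ k (c : Fin n → Fin k) → LabellingBound l K c
  withoutEmptyPart : ∀ {k} (c : Fin n → Fin (suc k)) j → ¬ Nonempty (part (V K) c j) →
                     LabellingBound l K c

  PartitionConnected⇒LabellingBound zero    c = pc zero c (λ ())
  PartitionConnected⇒LabellingBound (suc k) c with all? (λ j → nonempty? (part (V K) c j))
  ... | yes nonempty = pc (suc k) c nonempty
  ... | no ¬nonempty with ¬∀⟶∃¬ (suc k) _ (λ j → nonempty? (part (V K) c j)) ¬nonempty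
  ...   | j , empty = withoutEmptyPart c j empty

  withoutEmptyPart {k} c j empty =
    subst₂ (λ s t → s - l (V K) ≤ + t) (sym parts) (sym crossings)
      (PartitionConnected⇒LabellingBound k c′)
    where
    c′ = dropPart c j (∉-emptyPart (V K) c empty (proj₂ K-nonempty))
    c≡punchIn∘c′ : ∀ {v} → v ∈ V K → c v ≡ punchIn j (c′ v)
    c≡punchIn∘c′ v∈K = dropPart-punchIn c j _ (∉-emptyPart (V K) c empty v∈K)
    crossings : crossing K c ≡ crossing K c′
    crossings = crossing-relabel (punchIn-injective j _ _) c≡punchIn∘c′ K (λ v∈K → v∈K)
    parts : ΣFin (suc k) (λ i → l (part (V K) c i)) ≡ ΣFin k (λ i → l (part (V K) c′ i))
    parts = begin
      ΣFin (suc k) (λ i → l (part (V K) c i))                        ≡⟨ ΣFin-punchIn k (l ∘ part (V K) c) j ⟩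
      l (part (V K) c j) + ΣFin k (λ i → l (part (V K) c (punchIn j i))) ≡⟨ cong₂ _+_
          (trans (cong l (Empty-unique empty)) l⊥)
          (ΣFin-cong k (cong l ∘ part-relabel (punchIn-injective j _ _) c≡punchIn∘c′)) ⟩
      + 0 + ΣFin k (λ i → l (part (V K) c′ i))                        ≡⟨ ℤP.+-identityˡ _ ⟩
      ΣFin k (λ i → l (part (V K) c′ i))                              ∎
      where open ≡-Reasoning

spans : ∀ {n m} → Graph n m → Subset n → Fin m → Bool
spans G A i = lookup A (end₁ G i) ∧ lookup A (end₂ G i)

spanning nonSpanning : ∀ {n m} → Graph n m → Subset m → Subset n → Subset m
spanning    G H A = tabulate (λ i → lookup H i ∧ spans G A i)
nonSpanning G H A = tabulate (λ i → lookup H i ∧ not (spans G A i))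

Tight : ∀ {n m} → Graph n m → (Subset n → ℤ) → Subset m → Subset n → Set
Tight G l F A = ΣOver l A - l A ≤ + eIn G F A

module _ {n m} {G : Graph n m} {A : Subset n} where

  spans⁺ : ∀ {i} → end₁ G i ∈ A → end₂ G i ∈ A → spans G A i ≡ true
  spans⁺ a∈A b∈A = cong₂ _∧_ ([]=⇒lookup a∈A) ([]=⇒lookup b∈A)

  spans⁻ : ∀ {i} → spans G A i ≡ true → end₁ G i ∈ A × end₂ G i ∈ A
  spans⁻ {i} h = lookup⇒[]= _ A (∧-conicalˡ _ _ h) , lookup⇒[]= _ A (∧-conicalʳ (lookup A (end₁ G i)) _ h)

  ∈-spanning⁻ : ∀ {H i} → i ∈ spanning G H A → i ∈ H × spans G A i ≡ true
  ∈-spanning⁻ {H} {i} i∈ = lookup⇒[]= i H (∧-conicalˡ _ _ h) , ∧-conicalʳ (lookup H i) _ h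
    where h = trans (sym (lookup∘tabulate _ i)) ([]=⇒lookup i∈)

spans-mono : ∀ {n m} {G : Graph n m} {A A′ : Subset n} {i} → A ⊆ A′ → spans G A i ≡ true → spans G A′ i ≡ true
spans-mono {G = G} {A} {A′} {i} A⊆A′ A-spans with spans⁻ {G = G} {A = A} {i = i} A-spans
... | a∈A , b∈A = spans⁺ {G = G} {A = A′} {i = i} (A⊆A′ a∈A) (A⊆A′ b∈A)

restrict : ∀ {n m} {G : Graph n m} → Subgraph G → Subset n → Subgraph G
restrict {G = G} Q A = record { V = A ∩ V Q ; E = spanning G (E Q) A ; closed = closed′ }
  where
  closed′ : ∀ {i} → i ∈ spanning G (E Q) A → (end₁ G i ∈ A ∩ V Q) × (end₂ G i ∈ A ∩ V Q)
  closed′ i∈ with ∈-spanning⁻ {G = G} {A = A} i∈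
  ... | i∈Q , A-spans with spans⁻ {G = G} A-spans | closed Q i∈Q
  ...   | a∈A , b∈A | a∈Q , b∈Q = x∈p∩q⁺ (a∈A , a∈Q) , x∈p∩q⁺ (b∈A , b∈Q)

module _ {n k} (A : Subset n) (c : Fin n → Fin k) where

  extend : Fin n → Fin (k ℕ.+ n)
  extend v = if lookup A v then c v ↑ˡ n else k ↑ʳ v

  extend-∈ : ∀ {v} → v ∈ A → extend v ≡ c v ↑ˡ n
  extend-∈ v∈A rewrite []=⇒lookup v∈A = refl

  extend-∉ : ∀ {v} → v ∉ A → extend v ≡ k ↑ʳ v
  extend-∉ {v} v∉A with lookup A v in v∈A
  ... | true  = contradiction (lookup⇒[]= v A v∈A) v∉A
  ... | false = refl

  extend-↑ˡ⁻ : ∀ {v j} → extend v ≡ j ↑ˡ n → v ∈ A × c v ≡ j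
  extend-↑ˡ⁻ {v} eq with lookup A v in v∈A
  ... | true  = lookup⇒[]= v A v∈A , ↑ˡ-injective n _ _ eq
  ... | false = contradiction (sym eq) (↑ˡ≢↑ʳ _ _)

  extend-↑ʳ⁻ : ∀ {v w} → extend v ≡ k ↑ʳ w → v ∉ A × v ≡ w
  extend-↑ʳ⁻ {v} eq with lookup A v in v∈A
  ... | true  = contradiction eq (↑ˡ≢↑ʳ _ _)
  ... | false = lookup-false⇒∉ v∈A , ↑ʳ-injective k _ _ eq

  extend-≟ : ∀ {u v} → u ∈ A → v ∈ A → does (extend u ≟ extend v) ≡ does (c u ≟ c v)
  extend-≟ {u} {v} u∈A v∈A rewrite extend-∈ u∈A | extend-∈ v∈A =
    does-⇔ (mk⇔ (↑ˡ-injective n _ _) (cong (_↑ˡ n))) (c u ↑ˡ n ≟ c v ↑ˡ n) (c u ≟ c v)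

  extend-≢ : ∀ {u v} → ¬ (u ∈ A × v ∈ A) → u ≢ v → extend u ≢ extend v
  extend-≢ {u} {v} ¬both u≢v with u ∈? A | v ∈? A
  ... | yes u∈A | yes v∈A = contradiction (u∈A , v∈A) ¬both
  ... | yes u∈A | no v∉A  rewrite extend-∈ u∈A | extend-∉ v∉A = ↑ˡ≢↑ʳ _ _
  ... | no u∉A  | yes v∈A rewrite extend-∉ u∉A | extend-∈ v∈A = ↑ˡ≢↑ʳ _ _ ∘ sym
  ... | no u∉A  | no v∉A  rewrite extend-∉ u∉A | extend-∉ v∉A = u≢v ∘ ↑ʳ-injective k _ _

  part-extend-↑ˡ : ∀ B j → part B extend (j ↑ˡ n) ≡ part (A ∩ B) c j
  part-extend-↑ˡ B j = ⊆-antisym forth back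
    where
    forth : part B extend (j ↑ˡ n) ⊆ part (A ∩ B) c j
    forth v∈ with ∈-part⁻ B extend v∈
    ... | v∈B , eq with extend-↑ˡ⁻ eq
    ...   | v∈A , cv≡j = ∈-part⁺ (A ∩ B) c (x∈p∩q⁺ (v∈A , v∈B)) cv≡j
    back : part (A ∩ B) c j ⊆ part B extend (j ↑ˡ n)
    back v∈ with ∈-part⁻ (A ∩ B) c v∈
    ... | v∈A∩B , cv≡j with x∈p∩q⁻ A B v∈A∩B
    ...   | v∈A , v∈B = ∈-part⁺ B extend v∈B (trans (extend-∈ v∈A) (cong (_↑ˡ n) cv≡j))

  l-part-extend-↑ʳ : ∀ (l : Subset n → ℤ) → l ⊥ ≡ + 0 → ∀ B w →
                     l (part B extend (k ↑ʳ w)) ≡ (if lookup (B ∩ ∁ A) w then l ⁅ w ⁆ else + 0)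
  l-part-extend-↑ʳ l l⊥ B w with lookup (B ∩ ∁ A) w in w∈D
  ... | true  = cong l (⊆-antisym forth back)
    where
    forth : part B extend (k ↑ʳ w) ⊆ ⁅ w ⁆
    forth v∈ = subst (_∈ ⁅ w ⁆) (sym (proj₂ (extend-↑ʳ⁻ (proj₂ (∈-part⁻ B extend v∈))))) (x∈⁅x⁆ w)
    back : ⁅ w ⁆ ⊆ part B extend (k ↑ʳ w)
    back v∈⁅w⁆ with x∈⁅y⁆⇒x≡y w v∈⁅w⁆ | x∈p∩q⁻ B (∁ A) (lookup⇒[]= w _ w∈D)
    ... | refl | w∈B , w∈∁A = ∈-part⁺ B extend w∈B (extend-∉ (x∈∁p⇒x∉p w∈∁A))
  ... | false = trans (cong l (Empty-unique empty)) l⊥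
    where
    empty : ¬ Nonempty (part B extend (k ↑ʳ w))
    empty (v , v∈) with ∈-part⁻ B extend v∈
    ... | v∈B , eq with extend-↑ʳ⁻ eq
    ...   | v∉A , refl = lookup-false⇒∉ w∈D (x∈p∩q⁺ (v∈B , x∉p⇒x∈∁p v∉A))

  ΣFin-part-extend : ∀ (l : Subset n → ℤ) → l ⊥ ≡ + 0 → ∀ B →
    ΣFin (k ℕ.+ n) (λ j → l (part B extend j)) ≡ ΣFin k (λ j → l (part (A ∩ B) c j)) + ΣOver l (B ∩ ∁ A)
  ΣFin-part-extend l l⊥ B = trans (ΣFin-↑ k n _)
    (cong₂ _+_ (ΣFin-cong k (cong l ∘ part-extend-↑ˡ B)) (ΣFin-cong n (l-part-extend-↑ʳ l l⊥ B)))

  crossing-extend : ∀ {m} {G : Graph n m} (Q : Subgraph G) →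
                    crossing Q extend ≡ crossing (restrict Q A) c ℕ.+ ∣ nonSpanning G (E Q) A ∣
  crossing-extend {G = G} Q = ∣tabulate∣-+ _ _ _ pointwise
    where
    pointwise : ∀ i → toℕ (lookup (E Q) i ∧ not (does (extend (end₁ G i) ≟ extend (end₂ G i)))) ≡
                      toℕ (lookup (spanning G (E Q) A) i ∧ not (does (c (end₁ G i) ≟ c (end₂ G i))))
                        ℕ.+ toℕ (lookup (E Q) i ∧ not (spans G A i))
    pointwise i rewrite lookup∘tabulate (λ i → lookup (E Q) i ∧ spans G A i) i
      with lookup (E Q) i | spans G A i in A-spans
    ... | false | _     = refl
    ... | true  | true  with spans⁻ {G = G} A-spans
    ...   | a∈A , b∈A rewrite extend-≟ a∈A b∈A = sym (ℕP.+-identityʳ _)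
    pointwise i | true | false
      rewrite dec-false (extend (end₁ G i) ≟ extend (end₂ G i))
                (extend-≢ (λ (a∈A , b∈A) → contradiction (trans (sym A-spans) (spans⁺ {G = G} {i = i} a∈A b∈A)) λ ())
                          (loopless G i))
      = refl

eIn-+-nonSpanning-≤ : ∀ {n m} {G : Graph n m} {F H : Subset m} (A B : Subset n) → H ⊆ F →
  (∀ {i} → i ∈ H → spans G B i ≡ true) → eIn G F A ℕ.+ ∣ nonSpanning G H A ∣ ℕ.≤ eIn G F (A ∪ B)
eIn-+-nonSpanning-≤ {G = G} {F} {H} A B H⊆F H⊆B = ∣tabulate∣-+-≤ _ _ _ pointwise
  where
  A-spans⇒A∪B-spans : ∀ {i} → spans G A i ≡ true → spans G (A ∪ B) i ≡ true
  A-spans⇒A∪B-spans {i} = spans-mono {G = G} {A = A} {i = i} (p⊆p∪q B)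
  pointwise : ∀ i → toℕ (lookup F i ∧ spans G A i) ℕ.+ toℕ (lookup H i ∧ not (spans G A i)) ℕ.≤
                    toℕ (lookup F i ∧ spans G (A ∪ B) i)
  pointwise i with lookup H i in i∈H
  ... | true
    rewrite []=⇒lookup (H⊆F (lookup⇒[]= i H i∈H))
          | spans-mono {G = G} {A = B} {i = i} (q⊆p∪q A B) (H⊆B (lookup⇒[]= i H i∈H))
    with spans G A i
  ...   | true  = ℕP.≤-refl
  ...   | false = ℕP.≤-refl
  pointwise i | false with lookup F i | spans G A i in A-spans
  ...   | false | _     = ℕ.z≤n
  ...   | true  | false = ℕ.z≤n
  ...   | true  | true  rewrite A-spans⇒A∪B-spans {i} A-spans = ℕP.≤-refl

ΣOver-∪ : ∀ {n} (l : Subset n → ℤ) (A B : Subset n) → ΣOver l (A ∪ B) ≡ ΣOver l A + ΣOver l (B ∩ ∁ A)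
ΣOver-∪ {n} l A B = trans (ΣFin-cong n pointwise) (ΣFin-distrib-+ n _ _)
  where
  pointwise : ∀ v → (if lookup (A ∪ B) v then l ⁅ v ⁆ else + 0) ≡
                    (if lookup A v then l ⁅ v ⁆ else + 0) + (if lookup (B ∩ ∁ A) v then l ⁅ v ⁆ else + 0)
  pointwise v rewrite lookup-zipWith _∨_ v A B | lookup-zipWith _∧_ v B (∁ A) | lookup-map v not A
    with lookup A v | lookup B v
  ... | true  | true  = sym (ℤP.+-identityʳ _)
  ... | true  | false = sym (ℤP.+-identityʳ _)
  ... | false | true  = sym (ℤP.+-identityˡ _)
  ... | false | false = refl

cancel-bounds : ∀ (parts cross out ΣA ΣD lA lB lA∩B lA∪B eA eA∪B : ℤ) →
  (parts + ΣD) - lB ≤ cross + out → ΣA - lA ≤ eA → eA + out ≤ eA∪B →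
  eA∪B ≤ (ΣA + ΣD) - lA∪B → lA + lB ≤ lA∩B + lA∪B → parts - lA∩B ≤ cross
cancel-bounds parts cross out ΣA ΣD lA lB lA∩B lA∪B eA eA∪B h₁ h₂ h₃ h₄ h₅ =
  ℤP.0≤i-j⇒j≤i (subst (ℤ.0ℤ ≤_) (identity parts cross out ΣA ΣD lA lB lA∩B lA∪B eA eA∪B) total)
  where
  slack : ∀ {i j} → i ≤ j → ℤ.0ℤ ≤ j - i
  slack = ℤP.i≤j⇒0≤j-i
  total = ℤP.+-mono-≤ (ℤP.+-mono-≤ (slack h₁) (slack h₂))
            (ℤP.+-mono-≤ (slack h₃) (ℤP.+-mono-≤ (slack h₄) (slack h₅)))
  identity : ∀ parts cross out ΣA ΣD lA lB lA∩B lA∪B eA eA∪B →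
    ((cross + out) - ((parts + ΣD) - lB) + (eA - (ΣA - lA))) +
      ((eA∪B - (eA + out)) + ((((ΣA + ΣD) - lA∪B) - eA∪B) + ((lA∩B + lA∪B) - (lA + lB))))
    ≡ cross - (parts - lA∩B)
  identity = ℤ-Solver.solve-∀

restrict-partitionConnected :
  ∀ {n m} {G : Graph n m} (l : Subset n → ℤ) → l ⊥ ≡ + 0 → IntersectingSupermodular l →
  ∀ {F : Subset m} → Sparse G l F → (Q : Subgraph G) → E Q ⊆ F → PartitionConnected l Q →
  ∀ {A} → Tight G l F A → Nonempty (A ∩ V Q) → PartitionConnected l (restrict Q A)
restrict-partitionConnected {n} {G = G} l l⊥ supermodular {F} sparse Q Q⊆F pcQ {A} tight
  meet k c _ =
  cancel-bounds (ΣFin k (λ j → l (part (A ∩ V Q) c j))) (+ crossing (restrict Q A) c) (+ leaving)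
    (ΣOver l A) (ΣOver l (V Q ∩ ∁ A)) (l A) (l (V Q)) (l (A ∩ V Q)) (l (A ∪ V Q))
    (+ eIn G F A) (+ eIn G F (A ∪ V Q))
    bound tight counting sparse-A∪Q (supermodular A (V Q) meet)
  where
  leaving = ∣ nonSpanning G (E Q) A ∣
  bound : (ΣFin k (λ j → l (part (A ∩ V Q) c j)) + ΣOver l (V Q ∩ ∁ A)) - l (V Q) ≤
          + crossing (restrict Q A) c + + leaving
  bound = subst₂ (λ s t → s - l (V Q) ≤ t)
    (ΣFin-part-extend A c l l⊥ (V Q))
    (trans (cong +_ (crossing-extend A c Q)) (ℤP.pos-+ _ leaving))
    (PartitionConnected⇒LabellingBound l l⊥ Q (_ , proj₂ (x∈p∩q⁻ A (V Q) (proj₂ meet))) pcQ (k ℕ.+ n) (extend A c))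
  counting : + eIn G F A + + leaving ≤ + eIn G F (A ∪ V Q)
  counting = subst (_≤ + eIn G F (A ∪ V Q)) (ℤP.pos-+ _ leaving)
    (ℤ.+≤+ (eIn-+-nonSpanning-≤ {G = G} A (V Q) Q⊆F
      (λ i∈Q → spans⁺ {G = G} (proj₁ (closed Q i∈Q)) (proj₂ (closed Q i∈Q)))))
  sparse-A∪Q : + eIn G F (A ∪ V Q) ≤ (ΣOver l A + ΣOver l (V Q ∩ ∁ A)) - l (A ∪ V Q)
  sparse-A∪Q = subst (λ s → + eIn G F (A ∪ V Q) ≤ s - l (A ∪ V Q)) (ΣOver-∪ l A (V Q)) (sparse (A ∪ V Q))

∣q∣≤∣p∩q∣⇒q⊆p : ∀ {n} (p q : Subset n) → ∣ q ∣ ℕ.≤ ∣ p ∩ q ∣ → q ⊆ p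
∣q∣≤∣p∩q∣⇒q⊆p p q ∣q∣≤∣p∩q∣ {v} v∈q with v ∈? p
... | yes v∈p = v∈p
... | no  v∉p = contradiction ∣q∣≤∣p∩q∣
      (ℕP.<⇒≱ (p⊂q⇒∣p∣<∣q∣ (p∩q⊆q p q , v , v∈q , v∉p ∘ proj₁ ∘ x∈p∩q⁻ p q)))

restrict-contains : ∀ {n m} {G : Graph n m} {F : Subset m} {x y} {Q : Subgraph G} {A} →
  SubOfContaining F x y Q → x ∈ A → y ∈ A → SubOfContaining F x y (restrict Q A)
restrict-contains {G = G} {A = A} (Q⊆F , x∈Q , y∈Q) x∈A y∈A =
  Q⊆F ∘ proj₁ ∘ ∈-spanning⁻ {G = G} {A = A} , x∈p∩q⁺ (x∈A , x∈Q) , x∈p∩q⁺ (y∈A , y∈Q)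

minimal⇒⊆tight :
  ∀ {n m} {G : Graph n m} (l : Subset n → ℤ) → l ⊥ ≡ + 0 → IntersectingSupermodular l →
  ∀ {F : Subset m} → Sparse G l F → ∀ {x y} (Q : Subgraph G) → SubOfContaining F x y Q →
  PartitionConnected l Q →
  (∀ (Q′ : Subgraph G) → SubOfContaining F x y Q′ → PartitionConnected l Q′ →
    ∣ V Q ∣ ℕ.≤ ∣ V Q′ ∣) →
  ∀ {A} → Tight G l F A → x ∈ A → y ∈ A → V Q ⊆ A
minimal⇒⊆tight l l⊥ supermodular sparse Q Q-contains pcQ minimal {A} tight x∈A y∈A =
  ∣q∣≤∣p∩q∣⇒q⊆p A (V Q) (minimal (restrict Q A) (restrict-contains {Q = Q} Q-contains x∈A y∈A)
    (restrict-partitionConnected l l⊥ supermodular sparse Q (proj₁ Q-contains) pcQ tight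
      (_ , x∈p∩q⁺ (x∈A , proj₁ (proj₂ Q-contains)))))

module _ {n m} (G : Graph n m) (A : Subset n) where

  lookup-spanning : ∀ H i → lookup (spanning G H A) i ≡ (lookup H i ∧ spans G A i)
  lookup-spanning H i = lookup∘tabulate _ i

  spanning-update : ∀ H j b → spanning G (H [ j ]≔ b) A ≡ spanning G H A [ j ]≔ (b ∧ spans G A j)
  spanning-update H j b = lookup-ext _ _ pointwise
    where
    pointwise : ∀ i → lookup (spanning G (H [ j ]≔ b) A) i ≡ lookup (spanning G H A [ j ]≔ (b ∧ spans G A j)) i
    pointwise i with i ≟ j
    ... | yes refl rewrite lookup-spanning (H [ i ]≔ b) i | lookup∘update i H b
                         | lookup∘update i (spanning G H A) (b ∧ spans G A i) = refl
    ... | no i≢j   rewrite lookup-spanning (H [ j ]≔ b) i | lookup∘update′ i≢j H b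
                         | lookup∘update′ i≢j (spanning G H A) (b ∧ spans G A j) = sym (lookup-spanning H i)

  eIn-update : ∀ H j b → eIn G (H [ j ]≔ b) A ℕ.+ toℕ (lookup H j ∧ spans G A j) ≡
                          eIn G H A ℕ.+ toℕ (b ∧ spans G A j)
  eIn-update H j b = trans
    (cong₂ (λ t u → ∣ t ∣ ℕ.+ toℕ u) (spanning-update H j b) (sym (lookup-spanning H j)))
    (∣p[i]≔b∣ (spanning G H A) j (b ∧ spans G A j))

  eIn-swapEdge : ∀ {F e f} → e ∈ F → f ∉ F →
                 eIn G (swapEdge F e f) A ℕ.+ toℕ (spans G A e) ≡ eIn G F A ℕ.+ toℕ (spans G A f)
  eIn-swapEdge {F} {e} {f} e∈F f∉F = begin
    eIn G F′ A ℕ.+ toℕ (s e)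
      ≡⟨ cong (ℕ._+ toℕ (s e)) (ℕP.+-identityʳ _) ⟨
    eIn G F′ A ℕ.+ toℕ (false ∧ s f) ℕ.+ toℕ (s e)
      ≡⟨ cong (λ b → eIn G F′ A ℕ.+ toℕ (b ∧ s f) ℕ.+ toℕ (s e)) F₁[f]≡false ⟨
    eIn G F′ A ℕ.+ toℕ (lookup F₁ f ∧ s f) ℕ.+ toℕ (s e)
      ≡⟨ cong (ℕ._+ toℕ (s e)) (eIn-update F₁ f inside) ⟩
    eIn G F₁ A ℕ.+ toℕ (s f) ℕ.+ toℕ (s e)
      ≡⟨ xy∙z≈xz∙y (eIn G F₁ A) _ _ ⟩
    eIn G F₁ A ℕ.+ toℕ (s e) ℕ.+ toℕ (s f)
      ≡⟨ cong (λ b → eIn G F₁ A ℕ.+ toℕ (b ∧ s e) ℕ.+ toℕ (s f)) F[e]≡true ⟨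
    eIn G F₁ A ℕ.+ toℕ (lookup F e ∧ s e) ℕ.+ toℕ (s f)
      ≡⟨ cong (ℕ._+ toℕ (s f)) (eIn-update F e outside) ⟩
    eIn G F A ℕ.+ 0 ℕ.+ toℕ (s f)
      ≡⟨ cong (ℕ._+ toℕ (s f)) (ℕP.+-identityʳ _) ⟩
    eIn G F A ℕ.+ toℕ (s f)
      ∎
    where
    open ≡-Reasoning
    s  = spans G A
    F₁ = F [ e ]≔ outside
    F′ = F₁ [ f ]≔ inside
    f≢e : f ≢ e
    f≢e refl = f∉F e∈F
    F₁[f]≡false : lookup F₁ f ≡ false
    F₁[f]≡false = trans (lookup∘update′ f≢e F outside) (∉⇒lookup-false f∉F)
    F[e]≡true : lookup F e ≡ true
    F[e]≡true = []=⇒lookup e∈F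

toℕ-mono : ∀ {s t} → (s ≡ true → t ≡ true) → toℕ s ℕ.≤ toℕ t
toℕ-mono {true}  s⇒t rewrite s⇒t refl = ℕP.≤-refl
toℕ-mono {false} _   = ℕ.z≤n

toℕ≤1 : ∀ b → toℕ b ℕ.≤ 1
toℕ≤1 true  = ℕP.≤-refl
toℕ≤1 false = ℕ.z≤n

swap-preserves-bound : ∀ {a a′ : ℕ} {s t : Bool} {b : ℤ} → a′ ℕ.+ toℕ s ≡ a ℕ.+ toℕ t → + a ≤ b →
             (t ≡ true → s ≡ true) ⊎ + a ℤ.< b → + a′ ≤ b
swap-preserves-bound {a} {a′} {s} {t} eq a≤b (inj₁ t⇒s) = ℤP.≤-trans (ℤ.+≤+ a′≤a) a≤b
  where
  a′≤a = ℕP.+-cancelʳ-≤ (toℕ s) a′ a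
    (ℕP.≤-trans (ℕP.≤-reflexive eq) (ℕP.+-monoʳ-≤ a (toℕ-mono t⇒s)))
swap-preserves-bound {a} {a′} {s} {t} eq _ (inj₂ (ℤ.+<+ a<b)) = ℤ.+≤+ (begin
  a′                  ≤⟨ ℕP.m≤m+n a′ (toℕ s) ⟩
  a′ ℕ.+ toℕ s        ≡⟨ eq ⟩
  a ℕ.+ toℕ t         ≤⟨ ℕP.+-monoʳ-≤ a (toℕ≤1 t) ⟩
  a ℕ.+ 1             ≡⟨ ℕP.+-comm a 1 ⟩
  suc a               ≤⟨ a<b ⟩
  _                   ∎)
  where open ℕP.≤-Reasoning

mainTheorem18 : ∀ {n m : ℕ} (G : Graph n m) (l : Subset n → ℤ) →
    l ⊥ ≡ + 0 →
    IntersectingSupermodular l →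
    WeaklySubadditive l →
    (F : Subset m) → Sparse G l F →
    (f : Fin m) (x y : Fin n) → ends G f ≡ (x , y) → f ∉ F →
    (Q : Subgraph G) → SubOfContaining F x y Q → PartitionConnected l Q →
    (∀ (Q′ : Subgraph G) → SubOfContaining F x y Q′ → PartitionConnected l Q′ →
      ∣ V Q ∣ ℕ.≤ ∣ V Q′ ∣) →
    ∀ (e : Fin m) → e ∈ E Q → Sparse G l (swapEdge F e f)
mainTheorem18 G l l⊥ supermodular _ F sparse f x y ends-f f∉F Q Q-contains pcQ minimal e e∈Q A =
  swap-preserves-bound (eIn-swapEdge G A (proj₁ Q-contains e∈Q) f∉F) (sparse A) e-spans-or-slack
  where
  e-spans-or-slack : (spans G A f ≡ true → spans G A e ≡ true) ⊎ + eIn G F A ℤ.< ΣOver l A - l A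
  e-spans-or-slack with ΣOver l A - l A ℤP.≤? + eIn G F A
  ... | no slack  = inj₂ (ℤP.≰⇒> slack)
  ... | yes tight = inj₁ λ f-spans →
    let x∈A , y∈A = subst (λ (u , v) → u ∈ A × v ∈ A) ends-f (spans⁻ {G = G} {i = f} f-spans)
        Q⊆A       = minimal⇒⊆tight l l⊥ supermodular sparse Q Q-contains pcQ minimal tight x∈A y∈A
    in spans⁺ {G = G} {i = e} (Q⊆A (proj₁ (closed Q e∈Q))) (Q⊆A (proj₂ (closed Q e∈Q)))
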